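{- Let $p(\bar{x})=\{\varphi(\bar{x},\bar{a}_\beta):\beta<\lambda\}$ be a graph-like $\varphi$-type of cardinality $\lambda$ in $\prod_{\alpha<\lambda}\mathcal{M}_\alpha/\mathcal{D}$. If every graph-like function $f:\mathcal{P}_\omega(\lambda)\to\mathcal{D}$ has a multiplicative refinement, then $p(\bar{x})$ is realized.
   Context: $\lambda$ is an infinite cardinal, $\mathcal{D}$ a regular ultrafilter on $\lambda$, $(\mathcal{M}_\alpha)_{\alpha<\lambda}$ structures in a common language. $\mathcal{P}_\omega(\lambda)$ is the set of finite subsets of $\lambda$, $[X]^2$ the 2-element subsets. Given representatives $\bar r_\beta$ of the parameters, the Łoś map is $L(\Delta)=\{\alpha:\mathcal{M}_\alpha\models\exists\bar{x}\bigwedge_{\beta\in\Delta}\varphi(\bar{x},\bar{r}_\beta(\alpha))\}$; $p$ is graph-like if for some choice of representatives $L(\Delta)=\bigcap_{\Phi\in[\Delta]^2}L(\Phi)$ whenever $|\Delta|\ge2$. A function $f:\mathcal{P}_\omega(\lambda)\to\mathcal{D}$ is graph-like if $f(\Delta)=\bigcap_{\Phi\in[\Delta]^2}f(\Phi)$ whenever $|\Delta|\ge2$; a multiplicative refinement of $f$ is $g:\mathcal{P}_\omega(\lambda)\to\mathcal{D}$ with $g(\Delta)\subseteq f(\Delta)$ and $g(\Delta\cup\Phi)=g(\Delta)\cap g(\Phi)$ for all $\Delta,\Phi$. -}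

module Defs where

open import Level using (0ℓ)
open import Data.Nat using (ℕ)
open import Data.Empty using (⊥)
open import Data.Unit using (⊤)
open import Data.Product using (Σ; _×_; _,_; ∃)
open import Data.Sum using (_⊎_)
open import Data.List using (List; []; _∷_; _++_)
open import Data.List.Membership.Propositional using () renaming (_∈_ to _∈ₗ_)
open import Data.Vec using (Vec)
open import Relation.Nullary using (¬_)
open import Relation.Binary.PropositionalEquality using (_≢_)
open import Relation.Unary using (Pred; _⊆_; _∩_; _≐_; ∁; _∈_)
open import Function.Bundles using (_↣_; _⇔_)

Subset : Set → Set₁
Subset Λ = Pred Λ 0ℓ

Family : Set → Set₁
Family Λ = Subset Λ → Set

Infinite : Set → Set
Infinite Λ = ℕ ↣ Λ

record IsUltrafilter {Λ : Set} (D : Family Λ) : Set₁ where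
  field
    whole   : D (λ _ → ⊤)
    proper  : ¬ D (λ _ → ⊥)
    upward  : ∀ {X Y : Subset Λ} → X ⊆ Y → D X → D Y
    meet    : ∀ {X Y : Subset Λ} → D X → D Y → D (X ∩ Y)
    ultra   : ∀ (X : Subset Λ) → D X ⊎ D (∁ X)

-- Regular: a family {E β : β ∈ Λ} ⊆ D such that every α lies in only finitely
-- many E β (i.e. some finite list contains all β with α ∈ E β).
IsRegular : {Λ : Set} → Family Λ → Set₁
IsRegular {Λ} D =
  Σ (Λ → Subset Λ) λ E →
    ((β : Λ) → D (E β)) ×
    ((α : Λ) → Σ (List Λ) λ l → (β : Λ) → α ∈ E β → β ∈ₗ l)

-- Finite subsets of Λ (P_ω(λ)) are represented by lists; functions on P_ω(λ)
-- are list-functions that only depend on the set of elements of the list.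
SameElements : {Λ : Set} → List Λ → List Λ → Set
SameElements Δ Δ' = ∀ x → (x ∈ₗ Δ) ⇔ (x ∈ₗ Δ')

Respects : {Λ : Set} → (List Λ → Subset Λ) → Set
Respects {Λ} f = (Δ Δ' : List Λ) → SameElements Δ Δ' → f Δ ≐ f Δ'

AtLeastTwo : {Λ : Set} → List Λ → Set
AtLeastTwo {Λ} Δ = Σ Λ λ a → Σ Λ λ b → a ∈ₗ Δ × b ∈ₗ Δ × a ≢ b

PairMeet : {Λ : Set} → (List Λ → Subset Λ) → List Λ → Subset Λ
PairMeet {Λ} f Δ α =
  (a b : Λ) → a ∈ₗ Δ → b ∈ₗ Δ → a ≢ b → α ∈ f (a ∷ b ∷ [])

GraphLikeEq : {Λ : Set} → (List Λ → Subset Λ) → Set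
GraphLikeEq {Λ} f = (Δ : List Λ) → AtLeastTwo Δ → f Δ ≐ PairMeet f Δ

IntoFilter : {Λ : Set} → Family Λ → (List Λ → Subset Λ) → Set
IntoFilter {Λ} D f = Respects f × ((Δ : List Λ) → D (f Δ))

GraphLikeFun : {Λ : Set} → Family Λ → (List Λ → Subset Λ) → Set
GraphLikeFun D f = IntoFilter D f × GraphLikeEq f

IsMultRefinement : {Λ : Set} → Family Λ → (List Λ → Subset Λ) → (List Λ → Subset Λ) → Set
IsMultRefinement {Λ} D f g =
  IntoFilter D g ×
  ((Δ : List Λ) → g Δ ⊆ f Δ) ×
  ((Δ Φ : List Λ) → g (Δ ++ Φ) ≐ (g Δ ∩ g Φ))

HasMultRefinement : {Λ : Set} → Family Λ → (List Λ → Subset Λ) → Set₁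
HasMultRefinement {Λ} D f = Σ (List Λ → Subset Λ) λ g → IsMultRefinement D f g

-- The φ-type setting: for each α, a carrier M α and the interpretation
-- Rφ α x̄ ȳ of φ(x̄, ȳ) in M_α (x̄ of length n, ȳ of length k);
-- r β α is the α-th coordinate of a representative of the parameter ā_β.
-- Łoś map L(Δ) = {α : M_α ⊨ ∃x̄ ⋀_{β∈Δ} φ(x̄, r̄_β(α))}.
Los : {Λ : Set} (M : Λ → Set) (n k : ℕ)
      (Rφ : (α : Λ) → Vec (M α) n → Vec (M α) k → Set)
      (r : Λ → (α : Λ) → Vec (M α) k) → List Λ → Subset Λ
Los M n k Rφ r Δ α = Σ (Vec (M α) n) λ x → (β : _) → β ∈ₗ Δ → Rφ α x (r β α)

-- p is a (consistent) type in the ultraproduct: by Łoś, every finite subset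
-- is satisfiable, i.e. L(Δ) ∈ D for every finite Δ.
IsType : {Λ : Set} → Family Λ → (List Λ → Subset Λ) → Set
IsType {Λ} D L = (Δ : List Λ) → D (L Δ)

-- p is realized in ∏ M_α / D: some b̄ = [b] with ∏M_α/D ⊨ φ(b̄, ā_β) for all β,
-- which by Łoś means {α : M_α ⊨ φ(b(α), r̄_β(α))} ∈ D.
Realized : {Λ : Set} (D : Family Λ) (M : Λ → Set) (n k : ℕ)
           (Rφ : (α : Λ) → Vec (M α) n → Vec (M α) k → Set)
           (r : Λ → (α : Λ) → Vec (M α) k) → Set
Realized {Λ} D M n k Rφ r =
  Σ ((α : Λ) → Vec (M α) n) λ b → (β : Λ) → D (λ α → Rφ α (b α) (r β α))

{-# OPTIONS --safe #-}
-- Apply the hypothesis to the Łoś map L itself, which is graph-like, to get a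
-- multiplicative refinement g. By regularity each α lies in only finitely many
-- E β; among those β keep the ones with α ∈ g{β}, forming Δ_α. Multiplicativity
-- gives α ∈ g(Δ_α) ⊆ L(Δ_α), so b(α) can be chosen to satisfy φ(x̄, r̄_β(α)) for
-- every β ∈ Δ_α. Then b realizes φ(x̄, ā_β) on E β ∩ g{β} ∈ D.
module Submission where

open import Defs
open import Level using (0ℓ)
open import Data.Nat using (ℕ)
open import Data.Vec using (Vec; replicate)
open import Data.List using (List; []; _∷_; [_]; _++_; filter)
open import Data.List.Relation.Unary.Any using (here; there)
open import Data.List.Membership.Propositional using () renaming (_∈_ to _∈ₗ_)
open import Data.List.Membership.Propositional.Properties using (∈-filter⁺; ∈-filter⁻)
open import Data.Product using (_,_; proj₁; proj₂)
open import Relation.Binary.PropositionalEquality using (refl)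
open import Relation.Unary using (_∈_; _⊆_; _∩_; _≐_; Decidable)
open import Function.Bundles using (Equivalence)
open import Axiom.ExcludedMiddle using (ExcludedMiddle)

Multiplicative : {Λ : Set} → (List Λ → Subset Λ) → Set
Multiplicative g = ∀ Δ Φ → g (Δ ++ Φ) ≐ (g Δ ∩ g Φ)

∈-nonempty-of-∈-singletons : {Λ : Set} {g : List Λ → Subset Λ} → Multiplicative g →
  ∀ {α} γ Δ → (∀ β → β ∈ₗ γ ∷ Δ → α ∈ g [ β ]) → α ∈ g (γ ∷ Δ)
∈-nonempty-of-∈-singletons g-mult γ []      α∈g = α∈g γ (here refl)
∈-nonempty-of-∈-singletons g-mult γ (δ ∷ Δ) α∈g =
  proj₂ (g-mult [ γ ] (δ ∷ Δ))
    (α∈g γ (here refl) , ∈-nonempty-of-∈-singletons g-mult δ Δ (λ β β∈ → α∈g β (there β∈)))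

Los-respects : {Λ : Set} (M : Λ → Set) (n k : ℕ)
  (Rφ : (α : Λ) → Vec (M α) n → Vec (M α) k → Set) (r : Λ → (α : Λ) → Vec (M α) k) →
  Respects (Los M n k Rφ r)
Los-respects M n k Rφ r Δ Δ' same =
  (λ (x , sat) → x , λ β β∈ → sat β (Equivalence.from (same β) β∈)) ,
  (λ (x , sat) → x , λ β β∈ → sat β (Equivalence.to (same β) β∈))

Los-graphLikeFun : {Λ : Set} {D : Family Λ} (M : Λ → Set) (n k : ℕ)
  (Rφ : (α : Λ) → Vec (M α) n → Vec (M α) k → Set) (r : Λ → (α : Λ) → Vec (M α) k) →
  IsType D (Los M n k Rφ r) → GraphLikeEq (Los M n k Rφ r) →
  GraphLikeFun D (Los M n k Rφ r)
Los-graphLikeFun M n k Rφ r isType graphLike =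
  (Los-respects M n k Rφ r , isType) , graphLike

realized-of-multRefinement : ExcludedMiddle 0ℓ →
  {Λ : Set} {D : Family Λ} → IsUltrafilter D → IsRegular D →
  (M : Λ → Set) → ((α : Λ) → M α) → (n k : ℕ) →
  (Rφ : (α : Λ) → Vec (M α) n → Vec (M α) k → Set) (r : Λ → (α : Λ) → Vec (M α) k) →
  HasMultRefinement D (Los M n k Rφ r) → Realized D M n k Rφ r
realized-of-multRefinement em {Λ} {D} uf (E , E∈D , E-finite) M m n k Rφ r
  (g , (_ , g∈D) , g⊆L , g-mult) = b , b-realizes
  where
  L : List Λ → Subset Λ
  L = Los M n k Rφ r

  ∈-singleton? : ∀ α → Decidable (λ β → α ∈ g [ β ])
  ∈-singleton? α β = em

  candidates : Λ → List Λ
  candidates α = proj₁ (E-finite α)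

  Δ : Λ → List Λ
  Δ α = filter (∈-singleton? α) (candidates α)

  L-of-∈-singletons : ∀ α Φ → (∀ β → β ∈ₗ Φ → α ∈ g [ β ]) → α ∈ L Φ
  L-of-∈-singletons α []      _   = replicate n (m α) , λ _ ()
  L-of-∈-singletons α (γ ∷ Φ) α∈g = g⊆L (γ ∷ Φ) (∈-nonempty-of-∈-singletons g-mult γ Φ α∈g)

  witness : ∀ α → α ∈ L (Δ α)
  witness α = L-of-∈-singletons α (Δ α)
    (λ β β∈ → proj₂ (∈-filter⁻ (∈-singleton? α) {xs = candidates α} β∈))

  b : (α : Λ) → Vec (M α) n
  b α = proj₁ (witness α)

  E∩g⊆realizes : ∀ β → (E β ∩ g [ β ]) ⊆ (λ α → Rφ α (b α) (r β α))
  E∩g⊆realizes β {α} (α∈E , α∈g) =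
    proj₂ (witness α) β (∈-filter⁺ (∈-singleton? α) (proj₂ (E-finite α) β α∈E) α∈g)

  b-realizes : (β : Λ) → D (λ α → Rφ α (b α) (r β α))
  b-realizes β = IsUltrafilter.upward uf (E∩g⊆realizes β)
    (IsUltrafilter.meet uf (E∈D β) (g∈D [ β ]))

corollary6p7 : ExcludedMiddle 0ℓ →
    (Λ : Set) → Infinite Λ →
    (D : Family Λ) → IsUltrafilter D → IsRegular D →
    (M : Λ → Set) → ((α : Λ) → M α) →
    (n k : ℕ) →
    (Rφ : (α : Λ) → Vec (M α) n → Vec (M α) k → Set) →
    (r : Λ → (α : Λ) → Vec (M α) k) →
    IsType D (Los M n k Rφ r) →
    GraphLikeEq (Los M n k Rφ r) →
    ((f : List Λ → Subset Λ) → GraphLikeFun D f → HasMultRefinement D f) →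
    Realized D M n k Rφ r
corollary6p7 em Λ _ D uf regular M m n k Rφ r isType graphLike refinable =
  realized-of-multRefinement em uf regular M m n k Rφ r
    (refinable (Los M n k Rφ r) (Los-graphLikeFun {D = D} M n k Rφ r isType graphLike))
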